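{- Let $q$ and $z$ be complex numbers, let $m$ be a non-negative integer, let $\omega$ denote a primitive cube root of unity, and let $\boldsymbol j=(j_1,j_2,j_3)$. Then \begin{equation*} \sum_{j_1+j_2+j_3 = 3m} q^{\frac{1}{3}\left( j_2^2+j_2j_3+j_3^2 - g(j_1,j_2,j_3)\right)} z^{j_2+j_3} \begin{bmatrix} 3m \\ j_1,j_2,j_3\end{bmatrix}_q \omega^{\,j_2 + 2j_3} = (z;q)_{3m}, \end{equation*} where \begin{equation*} g(j_1,j_2,j_3) = \begin{cases} 2j_2 + j_3, & \text{if } j_2+ 2j_3 \equiv 2 \pmod{3};\\ j_2 + 2j_3, & \text{if } j_2 + 2j_3 \equiv 0,1 \pmod{3}.\end{cases} \end{equation*}
   Context: For a non-negative integer $k$, the $q$-shifted factorial is $(a;q)_k=\prod_{j=0}^{k-1}(1-aq^j)$. The $q$-multinomial coefficient is $\begin{bmatrix} n \\ j_1,j_2,j_3\end{bmatrix}_q = \frac{(q;q)_n}{(q;q)_{j_1}(q;q)_{j_2}(q;q)_{j_3}(q;q)_{n-j_1-j_2-j_3}}$, with the convention $1/(q;q)_n=0$ for $n<0$ (so the coefficient vanishes if some $j_i<0$ or $n<j_1+j_2+j_3$). The sum runs over non-negative integer triples $(j_1,j_2,j_3)$ with $j_1+j_2+j_3=3m$. -}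

module Defs where

open import Level using (Level)
open import Data.Nat as ℕ using (ℕ; zero; suc; _∸_; _%_; _/_)
open import Data.List using (List; upTo; foldr; map)
open import Algebra.Bundles using (CommutativeRing)

module _ {c ℓ : Level} (R : CommutativeRing c ℓ) where
  open CommutativeRing R

  pow : Carrier → ℕ → Carrier
  pow x zero    = 1#
  pow x (suc n) = x * pow x n

  sumTo : ℕ → (ℕ → Carrier) → Carrier
  sumTo n f = foldr _+_ 0# (map f (upTo n))

  qPoch : Carrier → Carrier → ℕ → Carrier
  qPoch a q zero    = 1#
  qPoch a q (suc k) = qPoch a q k * (1# - a * pow q k)

  qBin : Carrier → ℕ → ℕ → Carrier
  qBin q n       zero    = 1#
  qBin q zero    (suc k) = 0#
  qBin q (suc n) (suc k) = qBin q n k + pow q (suc k) * qBin q n (suc k)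

  -- q-multinomial [n ; j1, j2, j3]_q
  --   = (q;q)_n / ((q;q)_{j1} (q;q)_{j2} (q;q)_{j3} (q;q)_{n-j1-j2-j3}),
  -- written division-free as a product of q-binomials (zero when some
  -- lower index exceeds what remains).
  qMulti : Carrier → ℕ → ℕ → ℕ → ℕ → Carrier
  qMulti q n j₁ j₂ j₃ =
    qBin q n j₁ * (qBin q (n ∸ j₁) j₂ * qBin q (n ∸ j₁ ∸ j₂) j₃)

-- g(j1,j2,j3) (does not depend on j1)
g : ℕ → ℕ → ℕ
g j₂ j₃ with (j₂ ℕ.+ 2 ℕ.* j₃) % 3
... | 2 = 2 ℕ.* j₂ ℕ.+ j₃
... | _ = j₂ ℕ.+ 2 ℕ.* j₃

-- exponent (1/3)(j2^2 + j2 j3 + j3^2 - g(j)), always a non-negative integer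
qExp : ℕ → ℕ → ℕ
qExp j₂ j₃ = ((j₂ ℕ.* j₂ ℕ.+ j₂ ℕ.* j₃ ℕ.+ j₃ ℕ.* j₃) ∸ g j₂ j₃) / 3

module _ {c ℓ : Level} (R : CommutativeRing c ℓ) where
  open CommutativeRing R

  term : Carrier → Carrier → Carrier → ℕ → ℕ → ℕ → ℕ → Carrier
  term ω q z n j₁ j₂ j₃ =
    pow R q (qExp j₂ j₃) * (pow R z (j₂ ℕ.+ j₃) *
      (qMulti R q n j₁ j₂ j₃ * pow R ω (j₂ ℕ.+ 2 ℕ.* j₃)))

  -- sum over all non-negative triples with j1 + j2 + j3 = n:
  -- j2 ∈ [0,n], j3 ∈ [0,n-j2], j1 = n - j2 - j3
  lhs : Carrier → Carrier → Carrier → ℕ → Carrier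
  lhs ω q z n =
    sumTo R (suc n) (λ j₂ → sumTo R (suc (n ∸ j₂)) (λ j₃ →
      term ω q z n (n ∸ j₂ ∸ j₃) j₂ j₃))

{-# OPTIONS --safe #-}
-- The identity holds for every length n, not only for n = 3m.  Grouping the terms by
-- k = j₂ + j₃ and factoring the q-multinomial as [n, k] [k, j₂], the q-binomial theorem
-- reduces it to τ k = (-1)^k q^(k choose 2), where τ k is the inner sum over
-- j₂ + j₃ = k.  The q-exponent depends on the residue r of j₂ + 2 j₃ mod 3, and the
-- reflection j₂ ↔ j₃ exchanges r = 1 with r = 2, preserving the exponent on such pairs;
-- with ω² = -1 - ω this turns τ k into a sum σ k whose weights are q^e, -q^e, 0 for
-- r = 0, 1, 2.  Explicit formulas for the exponents of neighbouring indices, the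
-- q-Pascal rule and the same reflection then give σ (k + 1) = -q^k σ k.
module Submission where

open import Defs
open import Level using (Level)
open import Function using (_∘_)
open import Algebra.Bundles using (CommutativeRing)
open import Data.Nat as ℕ using (ℕ; zero; suc; _∸_; _≤_; _<_; z≤n; s≤s)
import Data.Nat.Properties as ℕₚ
open import Data.Nat.DivMod using (m≡m%n+[m/n]*n)
open import Data.List using (foldr; map; applyUpTo)
open import Data.Sum using (_⊎_; inj₁; inj₂)
open import Relation.Binary.PropositionalEquality as ≡ using (_≡_)

module Exponent where
  open import Data.Nat
  open import Data.Nat.Properties
  open import Data.Nat.DivMod
  open import Data.Nat.Divisibility using (n∣m*n)
  open import Data.Nat.Tactic.RingSolver using (solve-∀)
  open ≡ using (refl; trans; cong; cong₂)
  open ≡.≡-Reasoning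

  residue : ℕ → ℕ → ℕ
  residue a b = (a + 2 * b) % 3

  residue-cases : ∀ a b → residue a b ≡ 0 ⊎ residue a b ≡ 1 ⊎ residue a b ≡ 2
  residue-cases a b with residue a b | m%n<n (a + 2 * b) 3
  ... | 0 | _ = inj₁ refl
  ... | 1 | _ = inj₂ (inj₁ refl)
  ... | 2 | _ = inj₂ (inj₂ refl)
  ... | suc (suc (suc _)) | s≤s (s≤s (s≤s ()))

  residue-sucˡ : ∀ a b {r} → residue a b ≡ r → residue (suc a) b ≡ (1 + r) % 3
  residue-sucˡ a b refl = %-distribˡ-+ 1 (a + 2 * b) 3

  residue-sucʳ : ∀ a b {r} → residue a b ≡ r → residue a (suc b) ≡ (2 + r) % 3
  residue-sucʳ a b refl = begin
    (a + 2 * suc b) % 3   ≡⟨ cong (_% 3) (shift a b) ⟩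
    (2 + (a + 2 * b)) % 3 ≡⟨ %-distribˡ-+ 2 (a + 2 * b) 3 ⟩
    (2 + residue a b) % 3 ∎
    where
    shift : ∀ a b → a + 2 * suc b ≡ 2 + (a + 2 * b)
    shift = solve-∀

  residue-swap : ∀ a b {r} → residue a b ≡ r → residue b a ≡ (2 * r) % 3
  residue-swap a b refl = begin
    (b + 2 * a) % 3         ≡⟨ [m+kn]%n≡m%n (b + 2 * a) b 3 ⟨
    (b + 2 * a + b * 3) % 3 ≡⟨ cong (_% 3) (double a b) ⟩
    (2 * (a + 2 * b)) % 3   ≡⟨ %-distribˡ-* 2 (a + 2 * b) 3 ⟩
    (2 * residue a b) % 3   ∎
    where
    double : ∀ a b → b + 2 * a + b * 3 ≡ 2 * (a + 2 * b)
    double = solve-∀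

  residue-sucˡ-swap : ∀ a b → residue a b ≡ 0 ⊎ residue a b ≡ 1 →
                      residue (suc b) a ≡ 0 ⊎ residue (suc b) a ≡ 1
  residue-sucˡ-swap a b (inj₁ r≡0) = inj₂ (residue-sucˡ b a (residue-swap a b r≡0))
  residue-sucˡ-swap a b (inj₂ r≡1) = inj₁ (residue-sucˡ b a (residue-swap a b r≡1))

  g≡a+2b : ∀ a b → residue a b ≡ 0 ⊎ residue a b ≡ 1 → g a b ≡ a + 2 * b
  g≡a+2b a b (inj₁ r≡0) rewrite r≡0 = refl
  g≡a+2b a b (inj₂ r≡1) rewrite r≡1 = refl

  g≡2a+b : ∀ a b → residue a b ≡ 2 → g a b ≡ 2 * a + b
  g≡2a+b a b r≡2 rewrite r≡2 = refl

  norm : ℕ → ℕ → ℕ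
  norm a b = a * a + a * b + b * b

  norm-comm : ∀ a b → norm a b ≡ norm b a
  norm-comm = expanded
    where
    expanded : ∀ a b → a * a + a * b + b * b ≡ b * b + b * a + a * a
    expanded = solve-∀

  a+2b≤norm : ∀ a b → residue a b ≡ 0 ⊎ residue a b ≡ 1 → a + 2 * b ≤ norm a b
  a+2b≤norm zero    zero          _ = z≤n
  a+2b≤norm (suc a) zero          _ = m+n≤o⇒m≤o _ (≤-reflexive (excess a))
    where
    excess : ∀ a → suc a + 2 * 0 + (a * a + a) ≡ suc a * suc a + suc a * 0 + 0 * 0
    excess = solve-∀
  a+2b≤norm zero    (suc zero)    (inj₁ ())
  a+2b≤norm zero    (suc zero)    (inj₂ ())
  a+2b≤norm zero    (suc (suc b)) _ = m+n≤o⇒m≤o _ (≤-reflexive (excess b))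
    where
    excess : ∀ b → 0 + 2 * suc (suc b) + (b * b + 2 * b)
                   ≡ 0 * 0 + 0 * suc (suc b) + suc (suc b) * suc (suc b)
    excess = solve-∀
  a+2b≤norm (suc a) (suc b)       _ = m+n≤o⇒m≤o _ (≤-reflexive (excess a b))
    where
    excess : ∀ a b → suc a + 2 * suc b + (a * a + 2 * a + a * b + b * b + b)
                     ≡ suc a * suc a + suc a * suc b + suc b * suc b
    excess = solve-∀

  qExp-swap : ∀ a b → residue a b ≡ 1 → qExp b a ≡ qExp a b
  qExp-swap a b r≡1 = cong (_/ 3) (cong₂ _∸_ (norm-comm b a) (begin
    g b a     ≡⟨ g≡2a+b b a (residue-swap a b r≡1) ⟩
    2 * b + a ≡⟨ +-comm (2 * b) a ⟩
    a + 2 * b ≡⟨ g≡a+2b a b (inj₂ r≡1) ⟨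
    g a b     ∎))

  norm∸g-sucʳ : ∀ a b → residue a (suc b) ≡ 0 ⊎ residue a (suc b) ≡ 1 →
                norm a (suc b) ∸ g a (suc b) ≡ norm a b ∸ 1
  norm∸g-sucʳ a b r≢2 = begin
    norm a (suc b) ∸ g a (suc b)
      ≡⟨ cong₂ _∸_ (expand a b) (trans (g≡a+2b a (suc b) r≢2) (shift a b)) ⟩
    (a + 2 * b + 1) + norm a b ∸ ((a + 2 * b + 1) + 1)
      ≡⟨ [m+n]∸[m+o]≡n∸o (a + 2 * b + 1) (norm a b) 1 ⟩
    norm a b ∸ 1 ∎
    where
    expand : ∀ a b → a * a + a * suc b + suc b * suc b ≡ (a + 2 * b + 1) + (a * a + a * b + b * b)
    expand = solve-∀
    shift : ∀ a b → a + 2 * suc b ≡ (a + 2 * b + 1) + 1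
    shift = solve-∀

  qExp-sucʳ-swap : ∀ a b → residue a b ≡ 2 → qExp b (suc a) ≡ qExp a (suc b)
  qExp-sucʳ-swap a b r≡2 = cong (_/ 3) (begin
    norm b (suc a) ∸ g b (suc a) ≡⟨ norm∸g-sucʳ b a (inj₁ (residue-sucʳ b a (residue-swap a b r≡2))) ⟩
    norm b a ∸ 1                 ≡⟨ cong (_∸ 1) (norm-comm b a) ⟩
    norm a b ∸ 1                 ≡⟨ norm∸g-sucʳ a b (inj₂ (residue-sucʳ a b r≡2)) ⟨
    norm a (suc b) ∸ g a (suc b) ∎)

  norm∸g-sucˡ-swap : ∀ a b → residue a b ≡ 0 ⊎ residue a b ≡ 1 →
                     norm (suc b) a ∸ g (suc b) a ≡ norm a b ∸ g a b + b * 3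
  norm∸g-sucˡ-swap a b r≢2
    rewrite g≡a+2b a b r≢2 | g≡a+2b (suc b) a (residue-sucˡ-swap a b r≢2) = begin
    norm (suc b) a ∸ (suc b + 2 * a)                ≡⟨ cong (_∸ (suc b + 2 * a)) norm-sucˡ-swap ⟩
    w + b * 3 + (suc b + 2 * a) ∸ (suc b + 2 * a)   ≡⟨ m+n∸n≡m (w + b * 3) (suc b + 2 * a) ⟩
    w + b * 3                                       ∎
    where
    w : ℕ
    w = norm a b ∸ (a + 2 * b)
    expand : ∀ a b → suc b * suc b + suc b * a + a * a ≡ (a * a + a * b + b * b) + (2 * b + 1 + a)
    expand = solve-∀
    regroup : ∀ a b w → w + (a + 2 * b) + (2 * b + 1 + a) ≡ w + b * 3 + (suc b + 2 * a)
    regroup = solve-∀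
    norm-sucˡ-swap : norm (suc b) a ≡ w + b * 3 + (suc b + 2 * a)
    norm-sucˡ-swap = begin
      norm (suc b) a                      ≡⟨ expand a b ⟩
      norm a b + (2 * b + 1 + a)          ≡⟨ cong (_+ (2 * b + 1 + a)) (m∸n+n≡m (a+2b≤norm a b r≢2)) ⟨
      w + (a + 2 * b) + (2 * b + 1 + a)   ≡⟨ regroup a b w ⟩
      w + b * 3 + (suc b + 2 * a)         ∎

  qExp-sucˡ-swap : ∀ a b → residue a b ≡ 0 ⊎ residue a b ≡ 1 → qExp (suc b) a ≡ qExp a b + b
  qExp-sucˡ-swap a b r≢2 = begin
    qExp (suc b) a                   ≡⟨ cong (_/ 3) (norm∸g-sucˡ-swap a b r≢2) ⟩
    (norm a b ∸ g a b + b * 3) / 3   ≡⟨ +-distrib-/-∣ʳ (norm a b ∸ g a b) (n∣m*n b) ⟩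
    qExp a b + b * 3 / 3             ≡⟨ cong (qExp a b +_) (m*n/n≡m b 3) ⟩
    qExp a b + b                     ∎

open Exponent

select : ∀ {a} {A : Set a} → ℕ → A → A → A → A
select 0 x y z = x
select 1 x y z = y
select _ x y z = z

module _ {c ℓ : Level} (R : CommutativeRing c ℓ) where
  open CommutativeRing R hiding (zero)
  open import Algebra.Properties.Ring ring
    using (-‿distribˡ-*; -‿distribʳ-*; -‿involutive; -0#≈0#; -‿+-comm; +-inverseˡ-unique; [y-z]x≈yx-zx)
  open import Algebra.Solver.Ring.NaturalCoefficients.Default commutativeSemiring
    using (solve; _:=_; _:+_; _:*_; con)
  open import Relation.Binary.Reasoning.Setoid setoid

  ∑ : ℕ → (ℕ → Carrier) → Carrier
  ∑ zero    f = 0#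
  ∑ (suc n) f = f 0 + ∑ n (f ∘ suc)

  syntax ∑ n (λ i → x) = ∑[ i < n ] x

  foldr-applyUpTo≈∑ : ∀ n (h : ℕ → ℕ) f → foldr _+_ 0# (map f (applyUpTo h n)) ≈ ∑ n (f ∘ h)
  foldr-applyUpTo≈∑ zero    h f = refl
  foldr-applyUpTo≈∑ (suc n) h f = +-congˡ (foldr-applyUpTo≈∑ n (h ∘ suc) f)

  sumTo≈∑ : ∀ n f → sumTo R n f ≈ ∑ n f
  sumTo≈∑ n = foldr-applyUpTo≈∑ n (λ i → i)

  ∑-cong : ∀ n {f g : ℕ → Carrier} → (∀ {i} → i < n → f i ≈ g i) → ∑ n f ≈ ∑ n g
  ∑-cong zero    f≈g = refl
  ∑-cong (suc n) f≈g = +-cong (f≈g (s≤s z≤n)) (∑-cong n (λ i<n → f≈g (s≤s i<n)))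

  ∑-distrib-+ : ∀ n (f g : ℕ → Carrier) → ∑[ i < n ] (f i + g i) ≈ ∑ n f + ∑ n g
  ∑-distrib-+ zero    f g = sym (+-identityˡ 0#)
  ∑-distrib-+ (suc n) f g = trans (+-congˡ (∑-distrib-+ n (f ∘ suc) (g ∘ suc))) (interchange _ _ _ _)
    where
    interchange : ∀ a b c d → (a + b) + (c + d) ≈ (a + c) + (b + d)
    interchange = solve 4 (λ a b c d → ((a :+ b) :+ (c :+ d)) := ((a :+ c) :+ (b :+ d))) refl

  *-distribˡ-∑ : ∀ n x (f : ℕ → Carrier) → ∑[ i < n ] (x * f i) ≈ x * ∑ n f
  *-distribˡ-∑ zero    x f = sym (zeroʳ x)
  *-distribˡ-∑ (suc n) x f = trans (+-congˡ (*-distribˡ-∑ n x (f ∘ suc))) (sym (distribˡ x _ _))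

  -‿distrib-∑ : ∀ n (f : ℕ → Carrier) → ∑[ i < n ] (- f i) ≈ - ∑ n f
  -‿distrib-∑ zero    f = sym -0#≈0#
  -‿distrib-∑ (suc n) f = trans (+-congˡ (-‿distrib-∑ n (f ∘ suc))) (-‿+-comm _ _)

  ∑-init-last : ∀ n (f : ℕ → Carrier) → ∑ (suc n) f ≈ ∑ n f + f n
  ∑-init-last zero    f = +-comm _ _
  ∑-init-last (suc n) f = trans (+-congˡ (∑-init-last n (f ∘ suc))) (sym (+-assoc _ _ _))

  ∑-reverse : ∀ n (f : ℕ → Carrier) → ∑ (suc n) f ≈ ∑[ i < suc n ] f (n ∸ i)
  ∑-reverse zero    f = refl
  ∑-reverse (suc n) f = begin
    ∑ (suc (suc n)) f                     ≈⟨ ∑-init-last (suc n) f ⟩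
    ∑ (suc n) f + f (suc n)               ≈⟨ +-congʳ (∑-reverse n f) ⟩
    ∑[ i < suc n ] f (n ∸ i) + f (suc n)  ≈⟨ +-comm _ _ ⟩
    f (suc n) + ∑[ i < suc n ] f (n ∸ i)  ∎

  ∑-antidiagonals : ∀ n (h : ℕ → ℕ → Carrier) →
    ∑[ a < suc n ] ∑[ b < suc (n ∸ a) ] h a b ≈ ∑[ k < suc n ] ∑[ a < suc k ] h a (k ∸ a)
  ∑-antidiagonals zero    h = refl
  ∑-antidiagonals (suc n) h = begin
    ∑ (suc (suc n)) (h 0) + ∑[ a < suc n ] ∑[ b < suc (n ∸ a) ] h (suc a) b
      ≈⟨ +-congˡ (∑-antidiagonals n (h ∘ suc)) ⟩
    ∑ (suc (suc n)) (h 0) + ∑[ k < suc n ] ∑[ a < suc k ] h (suc a) (k ∸ a)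
      ≈⟨ +-congˡ (+-identityˡ _) ⟨
    ∑ (suc (suc n)) (h 0) + ∑[ k < suc (suc n) ] ∑[ a < k ] h (suc a) (k ∸ suc a)
      ≈⟨ ∑-distrib-+ (suc (suc n)) (h 0) (λ k → ∑[ a < k ] h (suc a) (k ∸ suc a)) ⟨
    ∑[ k < suc (suc n) ] ∑[ a < suc k ] h a (k ∸ a) ∎

  infixr 8 _^_
  _^_ : Carrier → ℕ → Carrier
  x ^ n = pow R x n

  ^-homo-* : ∀ x m n → x ^ (m ℕ.+ n) ≈ x ^ m * x ^ n
  ^-homo-* x zero    n = sym (*-identityˡ _)
  ^-homo-* x (suc m) n = trans (*-congˡ (^-homo-* x m n)) (sym (*-assoc _ _ _))

  ^-distrib-* : ∀ x y n → (x * y) ^ n ≈ x ^ n * y ^ n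
  ^-distrib-* x y zero    = sym (*-identityˡ 1#)
  ^-distrib-* x y (suc n) = trans (*-congˡ (^-distrib-* x y n)) (interchange x y _ _)
    where
    interchange : ∀ a b c d → (a * b) * (c * d) ≈ (a * c) * (b * d)
    interchange = solve 4 (λ a b c d → ((a :* b) :* (c :* d)) := ((a :* c) :* (b :* d))) refl

  x-0#≈x : ∀ x → x - 0# ≈ x
  x-0#≈x x = trans (+-congˡ -0#≈0#) (+-identityʳ x)

  select≈ : ∀ {m n} {x y z : Carrier} → m ≡ n → select m x y z ≈ select n x y z
  select≈ m≡n = reflexive (≡.cong (λ r → select r _ _ _) m≡n)

  module _ (q : Carrier) where
    private
      B : ℕ → ℕ → Carrier
      B = qBin R q

    qBin-vanish : ∀ {n k} → n < k → B n k ≈ 0#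
    qBin-vanish {zero}  {suc k} _         = refl
    qBin-vanish {suc n} {suc k} (s≤s n<k) = begin
      B n k + q ^ suc k * B n (suc k)
        ≈⟨ +-cong (qBin-vanish n<k) (*-congˡ (qBin-vanish (ℕₚ.m<n⇒m<1+n n<k))) ⟩
      0# + q ^ suc k * 0#
        ≈⟨ trans (+-identityˡ _) (zeroʳ _) ⟩
      0# ∎

    qBin-diag : ∀ n → B n n ≈ 1#
    qBin-diag zero    = refl
    qBin-diag (suc n) = begin
      B n n + q ^ suc n * B n (suc n)  ≈⟨ +-cong (qBin-diag n) (*-congˡ (qBin-vanish (ℕₚ.n<1+n n))) ⟩
      1# + q ^ suc n * 0#              ≈⟨ trans (+-congˡ (zeroʳ _)) (+-identityʳ _) ⟩
      1#                               ∎

    qBin-pascalʳ : ∀ {n} m k → m ℕ.+ k ≡ n → B (suc n) (suc k) ≈ B n (suc k) + q ^ m * B n k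
    qBin-pascalʳ zero k ≡.refl = begin
      B (suc k) (suc k)           ≈⟨ qBin-diag (suc k) ⟩
      1#                          ≈⟨ *-identityˡ 1# ⟨
      1# * 1#                     ≈⟨ +-identityˡ _ ⟨
      0# + 1# * 1#                ≈⟨ +-cong (qBin-vanish (ℕₚ.n<1+n k)) (*-congˡ (qBin-diag k)) ⟨
      B k (suc k) + 1# * B k k    ∎
    qBin-pascalʳ {suc n} (suc m) zero eq = begin
      1# + q ^ 1 * B (suc n) 1
        ≈⟨ +-congˡ (*-congˡ (qBin-pascalʳ m zero (ℕₚ.suc-injective eq))) ⟩
      1# + q ^ 1 * (B n 1 + q ^ m * 1#)
        ≈⟨ regroup q (B n 1) (q ^ m) ⟩
      (1# + q ^ 1 * B n 1) + q ^ suc m * 1# ∎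
      where
      regroup : ∀ q x y → 1# + (q * 1#) * (x + y * 1#) ≈ (1# + (q * 1#) * x) + (q * y) * 1#
      regroup = solve 3 (λ q x y → (con 1 :+ (q :* con 1) :* (x :+ y :* con 1))
                                := ((con 1 :+ (q :* con 1) :* x) :+ (q :* y) :* con 1)) refl
    qBin-pascalʳ {suc n} (suc m) (suc k) eq = begin
      B (suc n) (suc k) + q ^ suc (suc k) * B (suc n) (suc (suc k))
        ≈⟨ +-cong (qBin-pascalʳ (suc m) k (≡.trans (≡.sym (ℕₚ.+-suc m k)) (ℕₚ.suc-injective eq)))
                  (*-congˡ (qBin-pascalʳ m (suc k) (ℕₚ.suc-injective eq))) ⟩
      (B n (suc k) + q ^ suc m * B n k) + q ^ suc (suc k) * (B n (suc (suc k)) + q ^ m * B n (suc k))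
        ≈⟨ regroup _ _ _ _ _ _ ⟩
      (B n (suc k) + q ^ suc (suc k) * B n (suc (suc k))) + q ^ suc m * (B n k + q ^ suc k * B n (suc k)) ∎
      where
      regroup : ∀ x₁ x₂ x₃ qk qm q →
        (x₁ + (q * qm) * x₂) + (q * qk) * (x₃ + qm * x₁)
          ≈ (x₁ + (q * qk) * x₃) + (q * qm) * (x₂ + qk * x₁)
      regroup = solve 6 (λ x₁ x₂ x₃ qk qm q →
        ((x₁ :+ (q :* qm) :* x₂) :+ (q :* qk) :* (x₃ :+ qm :* x₁))
        := ((x₁ :+ (q :* qk) :* x₃) :+ (q :* qm) :* (x₂ :+ qk :* x₁))) refl

    qBin-sym : ∀ {n} a b → a ℕ.+ b ≡ n → B n a ≈ B n b
    qBin-sym zero b ≡.refl = sym (qBin-diag b)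
    qBin-sym (suc a) zero ≡.refl rewrite ℕₚ.+-identityʳ a = qBin-diag (suc a)
    qBin-sym {suc n} (suc a) (suc b) eq = begin
      B n a + q ^ suc a * B n (suc a)
        ≈⟨ +-cong (qBin-sym a (suc b) a+1+b≡n) (*-congˡ (qBin-sym (suc a) b 1+a+b≡n)) ⟩
      B n (suc b) + q ^ suc a * B n b
        ≈⟨ qBin-pascalʳ (suc a) b 1+a+b≡n ⟨
      B (suc n) (suc b) ∎
      where
      a+1+b≡n : a ℕ.+ suc b ≡ n
      a+1+b≡n = ℕₚ.suc-injective eq
      1+a+b≡n : suc a ℕ.+ b ≡ n
      1+a+b≡n = ≡.trans (≡.sym (ℕₚ.+-suc a b)) a+1+b≡n

    qBin-reflect : ∀ {n k} → k ≤ n → B n k ≈ B n (n ∸ k)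
    qBin-reflect {n} {k} k≤n = qBin-sym k (n ∸ k) (ℕₚ.m+[n∸m]≡n k≤n)

    ∑-pascal : ∀ k (f : ℕ → Carrier) →
      ∑[ a < suc (suc k) ] (f a * B (suc k) a) ≈ ∑[ a < suc k ] ((f (suc a) + q ^ a * f a) * B k a)
    ∑-pascal k f = begin
      f 0 * 1# + ∑[ a < suc k ] (f (suc a) * (B k a + q ^ suc a * B k (suc a)))
        ≈⟨ +-congˡ (∑-cong (suc k) (λ {a} _ → expand (f (suc a)) (B k a) (q ^ suc a) (B k (suc a)))) ⟩
      f 0 * 1# + ∑[ a < suc k ] (u a + v (suc a))
        ≈⟨ +-congˡ (∑-distrib-+ (suc k) u (v ∘ suc)) ⟩
      f 0 * 1# + (∑ (suc k) u + ∑ (suc k) (v ∘ suc))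
        ≈⟨ x+[y+z]≈y+[x+z] _ _ _ ⟩
      ∑ (suc k) u + (f 0 * 1# + ∑ (suc k) (v ∘ suc))
        ≈⟨ +-congˡ (+-congʳ (*-congʳ (*-identityˡ _))) ⟨
      ∑ (suc k) u + ∑ (suc (suc k)) v
        ≈⟨ +-congˡ (∑-init-last (suc k) v) ⟩
      ∑ (suc k) u + (∑ (suc k) v + (q ^ suc k * f (suc k)) * B k (suc k))
        ≈⟨ +-congˡ (trans (+-congˡ (trans (*-congˡ (qBin-vanish (ℕₚ.n<1+n k))) (zeroʳ _)))
                          (+-identityʳ _)) ⟩
      ∑ (suc k) u + ∑ (suc k) v
        ≈⟨ ∑-distrib-+ (suc k) u v ⟨
      ∑[ a < suc k ] (u a + v a)
        ≈⟨ ∑-cong (suc k) (λ {a} _ → sym (distribʳ (B k a) (f (suc a)) (q ^ a * f a))) ⟩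
      ∑[ a < suc k ] ((f (suc a) + q ^ a * f a) * B k a) ∎
      where
      u v : ℕ → Carrier
      u a = f (suc a) * B k a
      v a = (q ^ a * f a) * B k a
      expand : ∀ x y p w → x * (y + p * w) ≈ x * y + (p * x) * w
      expand = solve 4 (λ x y p w → (x :* (y :+ p :* w)) := (x :* y :+ (p :* x) :* w)) refl
      x+[y+z]≈y+[x+z] : ∀ x y z → x + (y + z) ≈ y + (x + z)
      x+[y+z]≈y+[x+z] = solve 3 (λ x y z → (x :+ (y :+ z)) := (y :+ (x :+ z))) refl

    ∑-reflect : ∀ k (F : ℕ → ℕ → Carrier) →
      ∑[ a < suc k ] (F a (k ∸ a) * B k a) ≈ ∑[ a < suc k ] (F (k ∸ a) a * B k a)
    ∑-reflect k F = trans (∑-reverse k (λ a → F a (k ∸ a) * B k a)) (∑-cong (suc k) reflected)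
      where
      reflected : ∀ {a} → a < suc k → F (k ∸ a) (k ∸ (k ∸ a)) * B k (k ∸ a) ≈ F (k ∸ a) a * B k a
      reflected (s≤s a≤k) rewrite ℕₚ.m∸[m∸n]≡n a≤k = *-congˡ (sym (qBin-reflect a≤k))

    ∑-antisymmetric≈0 : ∀ k (P : ℕ → ℕ → Carrier) →
      ∑[ a < suc k ] ((P a (k ∸ a) - P (k ∸ a) a) * B k a) ≈ 0#
    ∑-antisymmetric≈0 k P = begin
      ∑[ a < suc k ] ((P a (k ∸ a) - P (k ∸ a) a) * B k a)
        ≈⟨ ∑-cong (suc k) (λ {a} _ → [y-z]x≈yx-zx (B k a) (P a (k ∸ a)) (P (k ∸ a) a)) ⟩
      ∑[ a < suc k ] (P a (k ∸ a) * B k a - P (k ∸ a) a * B k a)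
        ≈⟨ ∑-distrib-+ (suc k) (λ a → P a (k ∸ a) * B k a) (λ a → - (P (k ∸ a) a * B k a)) ⟩
      ∑[ a < suc k ] (P a (k ∸ a) * B k a) + ∑[ a < suc k ] (- (P (k ∸ a) a * B k a))
        ≈⟨ +-congˡ (-‿distrib-∑ (suc k) (λ a → P (k ∸ a) a * B k a)) ⟩
      ∑[ a < suc k ] (P a (k ∸ a) * B k a) - ∑[ a < suc k ] (P (k ∸ a) a * B k a)
        ≈⟨ +-congˡ (-‿cong (∑-reflect k P)) ⟨
      ∑[ a < suc k ] (P a (k ∸ a) * B k a) - ∑[ a < suc k ] (P a (k ∸ a) * B k a)
        ≈⟨ -‿inverseʳ _ ⟩
      0# ∎

    -- ε k = (-1)^k q^(k choose 2)
    ε : ℕ → Carrier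
    ε zero    = 1#
    ε (suc k) = - (q ^ k * ε k)

    qPoch-suc : ∀ z n → (1# - z) * qPoch R (z * q) q n ≈ qPoch R z q (suc n)
    qPoch-suc z zero = begin
      (1# - z) * 1#        ≈⟨ *-identityʳ _ ⟩
      1# - z               ≈⟨ +-congˡ (-‿cong (*-identityʳ z)) ⟨
      1# - z * 1#          ≈⟨ *-identityˡ _ ⟨
      1# * (1# - z * 1#)   ∎
    qPoch-suc z (suc n) = begin
      (1# - z) * (qPoch R (z * q) q n * (1# - (z * q) * q ^ n))
        ≈⟨ *-assoc _ _ _ ⟨
      ((1# - z) * qPoch R (z * q) q n) * (1# - (z * q) * q ^ n)
        ≈⟨ *-cong (qPoch-suc z n) (+-congˡ (-‿cong (*-assoc _ _ _))) ⟩
      qPoch R z q (suc n) * (1# - z * q ^ suc n) ∎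

    ε-pascal : ∀ z k → ε (suc k) * z ^ suc k + q ^ k * (ε k * z ^ k) ≈ (1# - z) * (ε k * (z * q) ^ k)
    ε-pascal z k = begin
      - (q ^ k * ε k) * (z * z ^ k) + q ^ k * (ε k * z ^ k)
        ≈⟨ +-cong (-‿distribˡ-* _ _) (*-identityˡ _) ⟨
      - ((q ^ k * ε k) * (z * z ^ k)) + 1# * (q ^ k * (ε k * z ^ k))
        ≈⟨ +-cong (-‿cong (rearrange _ _ _ _)) (*-congˡ (rearrange′ _ _ _)) ⟩
      - (z * (ε k * (z ^ k * q ^ k))) + 1# * (ε k * (z ^ k * q ^ k))
        ≈⟨ +-congʳ (-‿distribˡ-* _ _) ⟩
      (- z) * (ε k * (z ^ k * q ^ k)) + 1# * (ε k * (z ^ k * q ^ k))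
        ≈⟨ distribʳ _ _ _ ⟨
      (- z + 1#) * (ε k * (z ^ k * q ^ k))
        ≈⟨ *-cong (+-comm _ _) (*-congˡ (^-distrib-* z q k)) ⟨
      (1# - z) * (ε k * (z * q) ^ k) ∎
      where
      rearrange : ∀ a e b c → (a * e) * (b * c) ≈ b * (e * (c * a))
      rearrange = solve 4 (λ a e b c → ((a :* e) :* (b :* c)) := (b :* (e :* (c :* a)))) refl
      rearrange′ : ∀ a e c → a * (e * c) ≈ e * (c * a)
      rearrange′ = solve 3 (λ a e c → (a :* (e :* c)) := (e :* (c :* a))) refl

    q-binomial : ∀ n z → ∑[ k < suc n ] (ε k * z ^ k * B n k) ≈ qPoch R z q n
    q-binomial zero    z = trans (+-identityʳ _) (trans (*-identityʳ _) (*-identityʳ _))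
    q-binomial (suc n) z = begin
      ∑[ k < suc (suc n) ] (ε k * z ^ k * B (suc n) k)
        ≈⟨ ∑-pascal n (λ k → ε k * z ^ k) ⟩
      ∑[ k < suc n ] ((ε (suc k) * z ^ suc k + q ^ k * (ε k * z ^ k)) * B n k)
        ≈⟨ ∑-cong (suc n) (λ {k} _ →
             trans (*-congʳ (ε-pascal z k)) (*-assoc (1# - z) (ε k * (z * q) ^ k) (B n k))) ⟩
      ∑[ k < suc n ] ((1# - z) * (ε k * (z * q) ^ k * B n k))
        ≈⟨ *-distribˡ-∑ (suc n) (1# - z) (λ k → ε k * (z * q) ^ k * B n k) ⟩
      (1# - z) * ∑[ k < suc n ] (ε k * (z * q) ^ k * B n k)
        ≈⟨ *-congˡ (q-binomial n (z * q)) ⟩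
      (1# - z) * qPoch R (z * q) q n
        ≈⟨ qPoch-suc z n ⟩
      qPoch R z q (suc n) ∎

    weight : ℕ → ℕ → Carrier
    weight a b = q ^ qExp a b

    signedWeight : ℕ → ℕ → Carrier
    signedWeight a b = select (residue a b) (weight a b) (- weight a b) 0#

    σ : ℕ → Carrier
    σ k = ∑[ a < suc k ] (signedWeight a (k ∸ a) * B k a)

    q^a*weight-sucˡ-swap : ∀ a b → residue a b ≡ 0 ⊎ residue a b ≡ 1 →
      q ^ a * weight (suc b) a ≈ q ^ (a ℕ.+ b) * weight a b
    q^a*weight-sucˡ-swap a b r≢2 = begin
      q ^ a * weight (suc b) a           ≈⟨ *-congˡ (reflexive (≡.cong (q ^_) (qExp-sucˡ-swap a b r≢2))) ⟩
      q ^ a * q ^ (qExp a b ℕ.+ b)       ≈⟨ *-congˡ (trans (^-homo-* q (qExp a b) b) (*-comm _ _)) ⟩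
      q ^ a * (q ^ b * weight a b)       ≈⟨ *-assoc _ _ _ ⟨
      (q ^ a * q ^ b) * weight a b       ≈⟨ *-congʳ (^-homo-* q a b) ⟨
      q ^ (a ℕ.+ b) * weight a b         ∎

    q^a*signedWeight-sucˡ-swap : ∀ a b →
      q ^ a * signedWeight (suc b) a ≈ - (q ^ (a ℕ.+ b) * signedWeight a b)
    q^a*signedWeight-sucˡ-swap a b with residue-cases a b
    ... | inj₁ r≡0 = begin
      q ^ a * signedWeight (suc b) a        ≈⟨ *-congˡ (select≈ (residue-sucˡ b a (residue-swap a b r≡0))) ⟩
      q ^ a * - weight (suc b) a            ≈⟨ -‿distribʳ-* _ _ ⟨
      - (q ^ a * weight (suc b) a)          ≈⟨ -‿cong (q^a*weight-sucˡ-swap a b (inj₁ r≡0)) ⟩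
      - (q ^ (a ℕ.+ b) * weight a b)        ≈⟨ -‿cong (*-congˡ (select≈ r≡0)) ⟨
      - (q ^ (a ℕ.+ b) * signedWeight a b)  ∎
    ... | inj₂ (inj₁ r≡1) = begin
      q ^ a * signedWeight (suc b) a        ≈⟨ *-congˡ (select≈ (residue-sucˡ b a (residue-swap a b r≡1))) ⟩
      q ^ a * weight (suc b) a              ≈⟨ q^a*weight-sucˡ-swap a b (inj₂ r≡1) ⟩
      q ^ (a ℕ.+ b) * weight a b            ≈⟨ -‿involutive _ ⟨
      - - (q ^ (a ℕ.+ b) * weight a b)      ≈⟨ -‿cong (-‿distribʳ-* _ _) ⟩
      - (q ^ (a ℕ.+ b) * - weight a b)      ≈⟨ -‿cong (*-congˡ (select≈ r≡1)) ⟨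
      - (q ^ (a ℕ.+ b) * signedWeight a b)  ∎
    ... | inj₂ (inj₂ r≡2) = begin
      q ^ a * signedWeight (suc b) a        ≈⟨ *-congˡ (select≈ (residue-sucˡ b a (residue-swap a b r≡2))) ⟩
      q ^ a * 0#                            ≈⟨ zeroʳ _ ⟩
      0#                                    ≈⟨ -0#≈0# ⟨
      - 0#                                  ≈⟨ -‿cong (zeroʳ _) ⟨
      - (q ^ (a ℕ.+ b) * 0#)                ≈⟨ -‿cong (*-congˡ (select≈ r≡2)) ⟨
      - (q ^ (a ℕ.+ b) * signedWeight a b)  ∎

    weight⁺₂ : ℕ → ℕ → Carrier
    weight⁺₂ a b = select (residue a b) 0# 0# (weight a (suc b))

    signedWeight-sucʳ-swap : ∀ a b → signedWeight b (suc a) ≈ weight⁺₂ a b - weight⁺₂ b a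
    signedWeight-sucʳ-swap a b with residue-cases a b
    ... | inj₁ r≡0 = begin
      signedWeight b (suc a)         ≈⟨ select≈ (residue-sucʳ b a (residue-swap a b r≡0)) ⟩
      0#                             ≈⟨ x-0#≈x 0# ⟨
      0# - 0#                        ≈⟨ +-cong (select≈ r≡0) (-‿cong (select≈ (residue-swap a b r≡0))) ⟨
      weight⁺₂ a b - weight⁺₂ b a    ∎
    ... | inj₂ (inj₁ r≡1) = begin
      signedWeight b (suc a)         ≈⟨ select≈ (residue-sucʳ b a (residue-swap a b r≡1)) ⟩
      - weight b (suc a)             ≈⟨ +-identityˡ _ ⟨
      0# - weight b (suc a)          ≈⟨ +-cong (select≈ r≡1) (-‿cong (select≈ (residue-swap a b r≡1))) ⟨
      weight⁺₂ a b - weight⁺₂ b a    ∎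
    ... | inj₂ (inj₂ r≡2) = begin
      signedWeight b (suc a)         ≈⟨ select≈ (residue-sucʳ b a (residue-swap a b r≡2)) ⟩
      weight b (suc a)               ≈⟨ reflexive (≡.cong (q ^_) (qExp-sucʳ-swap a b r≡2)) ⟩
      weight a (suc b)               ≈⟨ x-0#≈x _ ⟨
      weight a (suc b) - 0#          ≈⟨ +-cong (select≈ r≡2) (-‿cong (select≈ (residue-swap a b r≡2))) ⟨
      weight⁺₂ a b - weight⁺₂ b a    ∎

    signedWeight-pascal : ∀ {k a} → a ≤ k →
      signedWeight (k ∸ a) (suc a) + q ^ a * signedWeight (suc k ∸ a) a
        ≈ (weight⁺₂ a (k ∸ a) - weight⁺₂ (k ∸ a) a) + - (q ^ k * signedWeight a (k ∸ a))
    signedWeight-pascal {k} {a} a≤k = begin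
      signedWeight (k ∸ a) (suc a) + q ^ a * signedWeight (suc k ∸ a) a
        ≈⟨ +-congˡ (*-congˡ (reflexive (≡.cong (λ m → signedWeight m a) (ℕₚ.+-∸-assoc 1 a≤k)))) ⟩
      signedWeight (k ∸ a) (suc a) + q ^ a * signedWeight (suc (k ∸ a)) a
        ≈⟨ +-cong (signedWeight-sucʳ-swap a (k ∸ a)) (q^a*signedWeight-sucˡ-swap a (k ∸ a)) ⟩
      (weight⁺₂ a (k ∸ a) - weight⁺₂ (k ∸ a) a) + - (q ^ (a ℕ.+ (k ∸ a)) * signedWeight a (k ∸ a))
        ≈⟨ +-congˡ (-‿cong (*-congʳ (reflexive (≡.cong (q ^_) (ℕₚ.m+[n∸m]≡n a≤k))))) ⟩
      (weight⁺₂ a (k ∸ a) - weight⁺₂ (k ∸ a) a) + - (q ^ k * signedWeight a (k ∸ a)) ∎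

    σ-suc : ∀ k → σ (suc k) ≈ - (q ^ k * σ k)
    σ-suc k = begin
      σ (suc k)
        ≈⟨ ∑-reflect (suc k) signedWeight ⟩
      ∑[ a < suc (suc k) ] (signedWeight (suc k ∸ a) a * B (suc k) a)
        ≈⟨ ∑-pascal k (λ a → signedWeight (suc k ∸ a) a) ⟩
      ∑[ a < suc k ] ((signedWeight (k ∸ a) (suc a) + q ^ a * signedWeight (suc k ∸ a) a) * B k a)
        ≈⟨ ∑-cong (suc k) (λ {a} a<1+k →
             trans (*-congʳ (signedWeight-pascal (ℕₚ.≤-pred a<1+k))) (distrib-signed _ _ _ (B k a))) ⟩
      ∑[ a < suc k ] (antisymmetric a + - (q ^ k * summand a))
        ≈⟨ ∑-distrib-+ (suc k) antisymmetric (λ a → - (q ^ k * summand a)) ⟩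
      ∑ (suc k) antisymmetric + ∑[ a < suc k ] (- (q ^ k * summand a))
        ≈⟨ +-cong (∑-antisymmetric≈0 k weight⁺₂) (-‿distrib-∑ (suc k) (λ a → q ^ k * summand a)) ⟩
      0# + - ∑[ a < suc k ] (q ^ k * summand a)
        ≈⟨ trans (+-identityˡ _) (-‿cong (*-distribˡ-∑ (suc k) (q ^ k) summand)) ⟩
      - (q ^ k * σ k) ∎
      where
      summand antisymmetric : ℕ → Carrier
      summand a = signedWeight a (k ∸ a) * B k a
      antisymmetric a = (weight⁺₂ a (k ∸ a) - weight⁺₂ (k ∸ a) a) * B k a
      distrib-signed : ∀ d p s b → (d + - (p * s)) * b ≈ d * b + - (p * (s * b))
      distrib-signed d p s b =
        trans (distribʳ b d _) (+-congˡ (trans (sym (-‿distribˡ-* _ _)) (-‿cong (*-assoc p s b))))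

    σ≈ε : ∀ k → σ k ≈ ε k
    σ≈ε zero    = trans (+-identityʳ _) (*-identityʳ _)
    σ≈ε (suc k) = trans (σ-suc k) (-‿cong (*-congˡ (σ≈ε k)))

    module _ (ω : Carrier) (ω²+ω+1≈0 : ω * ω + ω + 1# ≈ 0#) where

      ω³≈1 : ω ^ 3 ≈ 1#
      ω³≈1 = begin
        ω ^ 3
          ≈⟨ +-inverseˡ-unique _ _ (trans (factor ω) (trans (*-congˡ ω²+ω+1≈0) (zeroʳ ω))) ⟩
        - (ω * ω + ω)
          ≈⟨ -‿cong (+-inverseˡ-unique _ _ ω²+ω+1≈0) ⟩
        - - 1#
          ≈⟨ -‿involutive 1# ⟩
        1# ∎
        where
        factor : ∀ w → w * (w * (w * 1#)) + (w * w + w) ≈ w * (w * w + w + 1#)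
        factor = solve 1 (λ w → (w :* (w :* (w :* con 1)) :+ (w :* w :+ w)) := (w :* (w :* w :+ w :+ con 1))) refl

      ω^3t≈1 : ∀ t → ω ^ (t ℕ.* 3) ≈ 1#
      ω^3t≈1 zero    = refl
      ω^3t≈1 (suc t) = begin
        ω ^ (3 ℕ.+ t ℕ.* 3)      ≈⟨ ^-homo-* ω 3 (t ℕ.* 3) ⟩
        ω ^ 3 * ω ^ (t ℕ.* 3)    ≈⟨ *-cong ω³≈1 (ω^3t≈1 t) ⟩
        1# * 1#                  ≈⟨ *-identityʳ 1# ⟩
        1#                       ∎

      ω^n≈ω^[n%3] : ∀ n → ω ^ n ≈ ω ^ (n ℕ.% 3)
      ω^n≈ω^[n%3] n = begin
        ω ^ n                                  ≈⟨ reflexive (≡.cong (ω ^_) (m≡m%n+[m/n]*n n 3)) ⟩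
        ω ^ (n ℕ.% 3 ℕ.+ (n ℕ./ 3) ℕ.* 3)      ≈⟨ ^-homo-* ω (n ℕ.% 3) ((n ℕ./ 3) ℕ.* 3) ⟩
        ω ^ (n ℕ.% 3) * ω ^ ((n ℕ./ 3) ℕ.* 3)  ≈⟨ *-congˡ (ω^3t≈1 (n ℕ./ 3)) ⟩
        ω ^ (n ℕ.% 3) * 1#                     ≈⟨ *-identityʳ _ ⟩
        ω ^ (n ℕ.% 3)                          ∎

      ω*w≈-w+[1+ω]w : ∀ w → ω ^ 1 * w ≈ - w + (1# + ω) * w
      ω*w≈-w+[1+ω]w w = begin
        (ω * 1#) * w         ≈⟨ trans (*-congʳ (*-identityʳ ω)) (sym (+-identityˡ _)) ⟩
        0# + ω * w           ≈⟨ +-congʳ (-‿inverseˡ w) ⟨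
        (- w + w) + ω * w    ≈⟨ +-assoc _ _ _ ⟩
        - w + (w + ω * w)    ≈⟨ +-congˡ (trans (distribʳ w 1# ω) (+-congʳ (*-identityˡ w))) ⟨
        - w + (1# + ω) * w   ∎

      ω²*w≈[1+ω]*-w : ∀ w → ω ^ 2 * w ≈ (1# + ω) * - w
      ω²*w≈[1+ω]*-w w = begin
        ω ^ 2 * w
          ≈⟨ +-inverseˡ-unique _ _ (trans (factor ω w) (trans (*-congʳ ω²+ω+1≈0) (zeroˡ w))) ⟩
        - ((1# + ω) * w)
          ≈⟨ -‿distribʳ-* _ _ ⟩
        (1# + ω) * - w ∎
        where
        factor : ∀ o x → (o * (o * 1#)) * x + (1# + o) * x ≈ (o * o + o + 1#) * x
        factor = solve 2 (λ o x → ((o :* (o :* con 1)) :* x :+ (con 1 :+ o) :* x)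
                                := ((o :* o :+ o :+ con 1) :* x)) refl

      weight₁ : ℕ → ℕ → Carrier
      weight₁ a b = select (residue a b) 0# (weight a b) 0#

      twistedWeight : ℕ → ℕ → Carrier
      twistedWeight a b = ω ^ (a ℕ.+ 2 ℕ.* b) * weight a b

      -- Reducing ω² to -1 - ω leaves a term antisymmetric in (a, b), by qExp-swap.
      twistedWeight-split : ∀ a b →
        twistedWeight a b ≈ signedWeight a b + (1# + ω) * (weight₁ a b - weight₁ b a)
      twistedWeight-split a b =
        trans (*-congʳ (ω^n≈ω^[n%3] (a ℕ.+ 2 ℕ.* b))) (by-residue (residue-cases a b))
        where
        weight₁-difference : ∀ {r} → residue a b ≡ r →
          weight₁ a b - weight₁ b a
            ≈ select r 0# (weight a b) 0# - select ((2 ℕ.* r) ℕ.% 3) 0# (weight b a) 0#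
        weight₁-difference r≡ = +-cong (select≈ r≡) (-‿cong (select≈ (residue-swap a b r≡)))
        by-residue : residue a b ≡ 0 ⊎ residue a b ≡ 1 ⊎ residue a b ≡ 2 →
          ω ^ residue a b * weight a b ≈ signedWeight a b + (1# + ω) * (weight₁ a b - weight₁ b a)
        by-residue (inj₁ r≡0) = begin
          ω ^ residue a b * weight a b       ≈⟨ *-congʳ (reflexive (≡.cong (ω ^_) r≡0)) ⟩
          1# * weight a b                    ≈⟨ trans (*-identityˡ _) (sym (+-identityʳ _)) ⟩
          weight a b + 0#                    ≈⟨ +-congˡ (trans (*-congˡ (x-0#≈x 0#)) (zeroʳ _)) ⟨
          weight a b + (1# + ω) * (0# - 0#)  ≈⟨ +-cong (select≈ r≡0) (*-congˡ (weight₁-difference r≡0)) ⟨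
          signedWeight a b + (1# + ω) * (weight₁ a b - weight₁ b a) ∎
        by-residue (inj₂ (inj₁ r≡1)) = begin
          ω ^ residue a b * weight a b
            ≈⟨ *-congʳ (reflexive (≡.cong (ω ^_) r≡1)) ⟩
          ω ^ 1 * weight a b
            ≈⟨ ω*w≈-w+[1+ω]w (weight a b) ⟩
          - weight a b + (1# + ω) * weight a b
            ≈⟨ +-congˡ (*-congˡ (x-0#≈x _)) ⟨
          - weight a b + (1# + ω) * (weight a b - 0#)
            ≈⟨ +-cong (select≈ r≡1) (*-congˡ (weight₁-difference r≡1)) ⟨
          signedWeight a b + (1# + ω) * (weight₁ a b - weight₁ b a) ∎
        by-residue (inj₂ (inj₂ r≡2)) = begin
          ω ^ residue a b * weight a b
            ≈⟨ *-congʳ (reflexive (≡.cong (ω ^_) r≡2)) ⟩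
          ω ^ 2 * weight a b
            ≈⟨ trans (ω²*w≈[1+ω]*-w (weight a b)) (sym (+-identityˡ _)) ⟩
          0# + (1# + ω) * - weight a b
            ≈⟨ +-congˡ (*-congˡ (trans (+-identityˡ _) (-‿cong weight-swap))) ⟨
          0# + (1# + ω) * (0# - weight b a)
            ≈⟨ +-cong (select≈ r≡2) (*-congˡ (weight₁-difference r≡2)) ⟨
          signedWeight a b + (1# + ω) * (weight₁ a b - weight₁ b a) ∎
          where
          weight-swap : weight b a ≈ weight a b
          weight-swap = sym (reflexive (≡.cong (q ^_) (qExp-swap b a (residue-swap a b r≡2))))

      τ : ℕ → Carrier
      τ k = ∑[ a < suc k ] (twistedWeight a (k ∸ a) * B k a)

      τ≈σ : ∀ k → τ k ≈ σ k
      τ≈σ k = begin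
        τ k
          ≈⟨ ∑-cong (suc k) (λ {a} _ →
               trans (*-congʳ (twistedWeight-split a (k ∸ a))) (distrib-scaled _ _ _ (B k a))) ⟩
        ∑[ a < suc k ] (signedWeight a (k ∸ a) * B k a + (1# + ω) * antisymmetric a)
          ≈⟨ ∑-distrib-+ (suc k) (λ a → signedWeight a (k ∸ a) * B k a) (((1# + ω) *_) ∘ antisymmetric) ⟩
        σ k + ∑[ a < suc k ] ((1# + ω) * antisymmetric a)
          ≈⟨ +-congˡ (*-distribˡ-∑ (suc k) (1# + ω) antisymmetric) ⟩
        σ k + (1# + ω) * ∑ (suc k) antisymmetric
          ≈⟨ +-congˡ (trans (*-congˡ (∑-antisymmetric≈0 k weight₁)) (zeroʳ _)) ⟩
        σ k + 0#
          ≈⟨ +-identityʳ _ ⟩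
        σ k ∎
        where
        antisymmetric : ℕ → Carrier
        antisymmetric a = (weight₁ a (k ∸ a) - weight₁ (k ∸ a) a) * B k a
        distrib-scaled : ∀ s u d b → (s + u * d) * b ≈ s * b + u * (d * b)
        distrib-scaled = solve 4 (λ s u d b → ((s :+ u :* d) :* b) := (s :* b :+ u :* (d :* b))) refl

      term-factor : ∀ z n {k a} → k ≤ n → a ≤ k →
        term R ω q z n (n ∸ a ∸ (k ∸ a)) a (k ∸ a) ≈ (z ^ k * B n k) * (twistedWeight a (k ∸ a) * B k a)
      term-factor z n {k} {a} k≤n a≤k
        rewrite ℕₚ.∸-+-assoc n a (k ∸ a) | ℕₚ.m+[n∸m]≡n a≤k | ℕₚ.m∸[m∸n]≡n k≤n = begin
        weight a b * (z ^ k * ((B n (n ∸ k) * (B k a * B b b)) * ω ^ (a ℕ.+ 2 ℕ.* b)))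
          ≈⟨ *-congˡ (*-congˡ (*-congʳ (*-cong (sym (qBin-reflect k≤n))
                                               (trans (*-congˡ (qBin-diag b)) (*-identityʳ _))))) ⟩
        weight a b * (z ^ k * ((B n k * B k a) * ω ^ (a ℕ.+ 2 ℕ.* b)))
          ≈⟨ rearrange _ _ _ _ _ ⟩
        (z ^ k * B n k) * (ω ^ (a ℕ.+ 2 ℕ.* b) * weight a b * B k a) ∎
        where
        b : ℕ
        b = k ∸ a
        rearrange : ∀ x zk bn bk w → x * (zk * ((bn * bk) * w)) ≈ (zk * bn) * ((w * x) * bk)
        rearrange = solve 5 (λ x zk bn bk w → (x :* (zk :* ((bn :* bk) :* w)))
                                           := ((zk :* bn) :* ((w :* x) :* bk))) refl

      lhs≈qPoch : ∀ z n → lhs R ω q z n ≈ qPoch R z q n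
      lhs≈qPoch z n = begin
        lhs R ω q z n
          ≈⟨ trans (sumTo≈∑ (suc n) _) (∑-cong (suc n) λ {a} _ → sumTo≈∑ (suc (n ∸ a)) (summand a)) ⟩
        ∑[ a < suc n ] ∑[ b < suc (n ∸ a) ] summand a b
          ≈⟨ ∑-antidiagonals n summand ⟩
        ∑[ k < suc n ] ∑[ a < suc k ] summand a (k ∸ a)
          ≈⟨ ∑-cong (suc n) antidiagonal ⟩
        ∑[ k < suc n ] (ε k * z ^ k * B n k)
          ≈⟨ q-binomial n z ⟩
        qPoch R z q n ∎
        where
        summand : ℕ → ℕ → Carrier
        summand a b = term R ω q z n (n ∸ a ∸ b) a b
        antidiagonal : ∀ {k} → k < suc n → ∑[ a < suc k ] summand a (k ∸ a) ≈ ε k * z ^ k * B n k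
        antidiagonal {k} (s≤s k≤n) = begin
          ∑[ a < suc k ] summand a (k ∸ a)
            ≈⟨ ∑-cong (suc k) (λ a<1+k → term-factor z n k≤n (ℕₚ.≤-pred a<1+k)) ⟩
          ∑[ a < suc k ] ((z ^ k * B n k) * (twistedWeight a (k ∸ a) * B k a))
            ≈⟨ *-distribˡ-∑ (suc k) (z ^ k * B n k) (λ a → twistedWeight a (k ∸ a) * B k a) ⟩
          (z ^ k * B n k) * τ k
            ≈⟨ *-congˡ (trans (τ≈σ k) (σ≈ε k)) ⟩
          (z ^ k * B n k) * ε k
            ≈⟨ trans (*-comm _ _) (sym (*-assoc _ _ _)) ⟩
          ε k * z ^ k * B n k ∎

open import Data.Nat using (ℕ; _*_)

theorem2 : {c ℓ : Level} (R : CommutativeRing c ℓ) →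
    let open CommutativeRing R renaming (_*_ to _·_) in
    (ω q z : Carrier) →
    ((ω · ω) + ω) + 1# ≈ 0# →
    (m : ℕ) →
    lhs R ω q z (3 * m) ≈ qPoch R z q (3 * m)
theorem2 R ω q z ω²+ω+1≈0 m = lhs≈qPoch R q ω ω²+ω+1≈0 z (3 * m)
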